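{- Let $G$ be a simple graph with $n \geq 5$ vertices and $m$ edges, with degree sequence $\Delta = d_1 \geq d_2 \geq \cdots \geq d_{n-1} \geq d_n = \delta > 0$. Then \[ M_1(G) \geq \Delta^2 + d_2^2 + \frac{(2m - \Delta - d_2)^2}{n-2} + \frac{1}{2}(d_{n-1} - \delta)^2 + \frac{2(n-2)}{n-4}\left(\frac{2m - \Delta - d_2}{n-2} - \frac{d_{n-1} + \delta}{2}\right)^2 \] and \[ M_1(G) \geq \Delta^2 + \delta^2 + \frac{(2m - \Delta - \delta)^2}{n-2} + \frac{1}{2}(d_2 - d_{n-1})^2 + \frac{2(n-2)}{n-4}\left(\frac{2m - \Delta - \delta}{n-2} - \frac{d_2 + d_{n-1}}{2}\right)^2. \] Equality holds in each of these inequalities if and only if $G$ is regular, or $G \in \Gamma_{3,n-2}$, or $G \in \Gamma_{2,n-2}$, or $G \in \Gamma_{3,n-1}$, or $G \in \Gamma_{2,n-1}$, or $G \in \Gamma_{3,n}$, or $G \in \Gamma_{2,n}$, or $G \in \Gamma_{1,n-2}$, or $G \in \Gamma_{1,n-1}$.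
   Context: $M_1(G) = \sum_{i=1}^n d_i^2$. For $1 \le i < j \le n$, $\Gamma_{i,j}$ denotes the class of graphs (with vertices ordered so that $d_1 \ge \cdots \ge d_n$) such that $d_i = d_{i+1} = \cdots = d_j$. -}

module Defs where

open import Data.Bool using (Bool; true; false; if_then_else_)
open import Data.Nat using (ℕ; zero; suc; _≤_; _<ᵇ_)
open import Data.Nat as ℕ using ()
open import Data.Fin using (Fin; toℕ)
open import Data.List using (List; map; allFin)
open import Data.Nat.ListAction using (sum)
open import Relation.Nullary using (yes; no)
open import Data.Sum using (_⊎_)
open import Data.Integer using (+_)
open import Data.Rational using (ℚ; _/_; _*_; 0ℚ)
open import Relation.Binary.PropositionalEquality using (_≡_)

record SimpleGraph (n : ℕ) : Set where
  field
    adj    : Fin n → Fin n → Bool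
    sym    : ∀ i j → adj i j ≡ adj j i
    irrefl : ∀ i → adj i i ≡ false
open SimpleGraph public

deg : ∀ {n} → SimpleGraph n → Fin n → ℕ
deg {n} G i = sum (map (λ j → if adj G i j then 1 else 0) (allFin n))

edges : ∀ {n} → SimpleGraph n → ℕ
edges {n} G = sum (map (λ i → sum (map (λ j →
  if (toℕ i <ᵇ toℕ j) then (if adj G i j then 1 else 0) else 0) (allFin n))) (allFin n))

M1 : ∀ {n} → SimpleGraph n → ℕ
M1 {n} G = sum (map (λ i → deg G i ℕ.* deg G i) (allFin n))

DegreeOrdered : ∀ {n} → SimpleGraph n → Set
DegreeOrdered G = ∀ i j → toℕ i ≤ toℕ j → deg G j ≤ deg G i

-- 1-indexed degree sequence: d k = degree of the k-th vertex (k = 1..n), 0 outside range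
d : ∀ {n} → SimpleGraph n → ℕ → ℕ
d {zero}  G k = 0
d {suc n} G zero = 0
d {suc n} G (suc k) with k ℕ.<? suc n
... | yes p = deg G (Data.Fin.fromℕ< p)
... | no _ = 0

regular : ∀ {n} → SimpleGraph n → Set
regular G = ∀ u v → deg G u ≡ deg G v

Γ : ∀ {n} → ℕ → ℕ → SimpleGraph n → Set
Γ i j G = ∀ k → i ≤ k → k ≤ j → d G k ≡ d G i

ℕ→ℚ : ℕ → ℚ
ℕ→ℚ k = + k / 1

-- division of a rational by a natural number (only used with nonzero divisors)
divℕ : ℚ → ℕ → ℚ
divℕ p zero    = 0ℚ
divℕ p (suc k) = p * (+ 1 / suc k)

module _ {n : ℕ} (G : SimpleGraph n) where
  private
    sq : ℚ → ℚ
    sq x = x Data.Rational.* x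
    Δ′ δ′ d₂ dₙ₋₁ m′ : ℚ
    Δ′   = ℕ→ℚ (d G 1)
    d₂   = ℕ→ℚ (d G 2)
    dₙ₋₁ = ℕ→ℚ (d G (n ℕ.∸ 1))
    δ′   = ℕ→ℚ (d G n)
    m′   = ℕ→ℚ (edges G)
    half : ℚ
    half = + 1 / 2

  bound1 : ℚ
  bound1 = sq Δ′ Data.Rational.+ sq d₂
    Data.Rational.+ divℕ (sq (ℕ→ℚ 2 Data.Rational.* m′ Data.Rational.- Δ′ Data.Rational.- d₂)) (n ℕ.∸ 2)
    Data.Rational.+ half Data.Rational.* sq (dₙ₋₁ Data.Rational.- δ′)
    Data.Rational.+ divℕ (ℕ→ℚ (2 ℕ.* (n ℕ.∸ 2))) (n ℕ.∸ 4)
      Data.Rational.* sq (divℕ (ℕ→ℚ 2 Data.Rational.* m′ Data.Rational.- Δ′ Data.Rational.- d₂) (n ℕ.∸ 2)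
                          Data.Rational.- half Data.Rational.* (dₙ₋₁ Data.Rational.+ δ′))

  bound2 : ℚ
  bound2 = sq Δ′ Data.Rational.+ sq δ′
    Data.Rational.+ divℕ (sq (ℕ→ℚ 2 Data.Rational.* m′ Data.Rational.- Δ′ Data.Rational.- δ′)) (n ℕ.∸ 2)
    Data.Rational.+ half Data.Rational.* sq (d₂ Data.Rational.- dₙ₋₁)
    Data.Rational.+ divℕ (ℕ→ℚ (2 ℕ.* (n ℕ.∸ 2))) (n ℕ.∸ 4)
      Data.Rational.* sq (divℕ (ℕ→ℚ 2 Data.Rational.* m′ Data.Rational.- Δ′ Data.Rational.- δ′) (n ℕ.∸ 2)
                          Data.Rational.- half Data.Rational.* (d₂ Data.Rational.+ dₙ₋₁))

  EqualityCase : Set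
  EqualityCase = regular G
    ⊎ Γ 3 (n ℕ.∸ 2) G ⊎ Γ 2 (n ℕ.∸ 2) G
    ⊎ Γ 3 (n ℕ.∸ 1) G ⊎ Γ 2 (n ℕ.∸ 1) G
    ⊎ Γ 3 n G ⊎ Γ 2 n G
    ⊎ Γ 1 (n ℕ.∸ 2) G ⊎ Γ 1 (n ℕ.∸ 1) G

-- Let T and Q be the sum and the sum of squares of the n − 4 middle degrees
-- d₃, …, dₙ₋₂.  Lagrange's identity gives (n − 4) Q = T² + D, where
-- D = Σ_{3 ≤ i < j ≤ n−2} (dᵢ − dⱼ)², and writing 2m = Δ + d₂ + T + dₙ₋₁ + δ
-- (handshake lemma) and completing the square shows that M₁(G) exceeds each
-- bound by exactly D / (n − 4).  So both inequalities hold, with equality iff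
-- d₃ = ⋯ = dₙ₋₂, i.e. G ∈ Γ_{3,n−2}; every other class in the list is
-- contained in Γ_{3,n−2}.

module Submission where

open import Defs hiding (sym)
open import Data.Nat using (ℕ; zero; suc; _≤_; _<_; s≤s; z≤n)
open import Data.Rational using (ℚ) renaming (_≤_ to _≤ℚ_; _+_ to _+ℚ_)
open import Data.Product using (_×_; _,_)
open import Function.Bundles using (_⇔_; mk⇔)
open import Relation.Binary.PropositionalEquality

module BoundIdentity where
  import Data.Nat as ℕ
  open import Data.Nat.Coprimality as Coprime using (1-coprimeTo)
  open import Data.Integer as ℤ using (+_)
  import Data.Integer.Properties as ℤ
  open import Data.Rational
    using (mkℚ; ↥_; _+_; _*_; _-_; _/_; ½; 0ℚ; 1ℚ; NonNegative; _≟_)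
  import Data.Rational.Properties as ℚ
  open import Algebra.Properties.Group ℚ.+-0-group using (identityʳ-unique)
  open import Level using (0ℓ)
  open import Relation.Nullary.Decidable using (dec⇒maybe)
  open import Tactic.RingSolver.Core.AlmostCommutativeRing
    using (AlmostCommutativeRing; fromCommutativeRing)
  open import Tactic.RingSolver using (solve-∀; solve)
  open import Data.List using (_∷_; [])
  open ≡-Reasoning

  ℕ→ℚ≡mkℚ : ∀ n → ℕ→ℚ n ≡ mkℚ (+ n) 0 (Coprime.sym (1-coprimeTo n))
  ℕ→ℚ≡mkℚ n = ℚ.normalize-coprime (Coprime.sym (1-coprimeTo n))

  ℕ→ℚ-homo-+ : ∀ m n → ℕ→ℚ (m ℕ.+ n) ≡ ℕ→ℚ m + ℕ→ℚ n
  ℕ→ℚ-homo-+ m n rewrite ℕ→ℚ≡mkℚ m | ℕ→ℚ≡mkℚ n = ℚ./-cong (begin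
    + (m ℕ.+ n)               ≡⟨ ℤ.pos-+ m n ⟩
    + m ℤ.+ + n               ≡⟨ cong₂ ℤ._+_ (ℤ.*-identityʳ (+ m)) (ℤ.*-identityʳ (+ n)) ⟨
    + m ℤ.* + 1 ℤ.+ + n ℤ.* + 1 ∎) refl

  ℕ→ℚ-homo-* : ∀ m n → ℕ→ℚ (m ℕ.* n) ≡ ℕ→ℚ m * ℕ→ℚ n
  ℕ→ℚ-homo-* m n rewrite ℕ→ℚ≡mkℚ m | ℕ→ℚ≡mkℚ n = ℚ./-cong (ℤ.pos-* m n) refl

  ℕ→ℚ-injective : ∀ {m n} → ℕ→ℚ m ≡ ℕ→ℚ n → m ≡ n
  ℕ→ℚ-injective {m} {n} eq rewrite ℕ→ℚ≡mkℚ m | ℕ→ℚ≡mkℚ n =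
    ℤ.+-injective (cong ↥_ eq)

  1/suc*ℕ→ℚ≡1 : ∀ m → (+ 1 / suc m) * ℕ→ℚ (suc m) ≡ 1ℚ
  1/suc*ℕ→ℚ≡1 m rewrite ℚ.normalize-coprime (1-coprimeTo (suc m)) | ℕ→ℚ≡mkℚ (suc m) =
    ℚ.*-inverseˡ (mkℚ (+ suc m) 0 (Coprime.sym (1-coprimeTo (suc m))))

  ℚ-ring : AlmostCommutativeRing 0ℓ 0ℓ
  ℚ-ring = fromCommutativeRing ℚ.+-*-commutativeRing (λ q → dec⇒maybe (0ℚ ≟ q))

  -- For u = 1/(K + 2) and v = 1/K this is, with p = (a + b)/2, the square completion
  -- K (T + 2p)² + 2 (T − K p)² = (K + 2) (T² + 2 K p²).  As a polynomial identity the two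
  -- sides differ by the combination below of ε = u (K + 2) − 1, η = v K − 1 and
  -- ζ = K Q − T² − E, all of which vanish under the hypotheses of bound-identity.
  bound-identity-certificate : ∀ K u v x y a b T Q E →
    let s = x + y + (T + a + b) - x - y; p = ½ * (a + b); w = T - K * p; N = ℕ→ℚ 2 + K
        ε = u * N - 1ℚ; η = v * K - 1ℚ; ζ = K * Q - (T * T + E) in
    x * x + y * y + s * s * u + ½ * ((a - b) * (a - b))
      + ℕ→ℚ 2 * N * v * ((s * u - p) * (s * u - p)) + E * v
    ≡ x * x + y * y + (Q + a * a + b * b)
      + η * (ℕ→ℚ 2 * p * p - u * s * s + Q)
      + ε * (v * (T * T + ℕ→ℚ 2 * K * p * p) + ℕ→ℚ 2 * u * v * w * w
             + ℕ→ℚ 2 * N * v * p * (ℕ→ℚ 2 * u * w + p * ε))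
      - v * ζ
  bound-identity-certificate = solve-∀ ℚ-ring

  bound-identity : ∀ {K u v} → u * (ℕ→ℚ 2 + K) ≡ 1ℚ → v * K ≡ 1ℚ →
    ∀ x y a b T Q E {σ c} →
    σ ≡ x + y + (T + a + b) → c ≡ ℕ→ℚ 2 * (ℕ→ℚ 2 + K) → K * Q ≡ T * T + E →
    let s = σ - x - y in
    x * x + y * y + (Q + a * a + b * b)
      ≡ x * x + y * y + s * s * u + ½ * ((a - b) * (a - b))
        + c * v * ((s * u - ½ * (a + b)) * (s * u - ½ * (a + b))) + E * v
  bound-identity {K} {u} {v} uN≡1 vK≡1 x y a b T Q E refl refl KQ≡T²+E =
    sym (trans (bound-identity-certificate K u v x y a b T Q E)
               (vanish v (p≡q⇒p-q≡0 vK≡1) (p≡q⇒p-q≡0 uN≡1) (p≡q⇒p-q≡0 KQ≡T²+E)))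
    where
    p≡q⇒p-q≡0 : ∀ {p q} → p ≡ q → p - q ≡ 0ℚ
    p≡q⇒p-q≡0 {p} refl = ℚ.+-inverseʳ p
    vanish : ∀ {l P R} w {η ε ζ} → η ≡ 0ℚ → ε ≡ 0ℚ → ζ ≡ 0ℚ → l + η * P + ε * R - w * ζ ≡ l
    vanish {l} {P} {R} w refl refl refl = solve (l ∷ P ∷ R ∷ w ∷ []) ℚ-ring

  -- bound1 G and bound2 G unfold to bound n Δ d₂ dₙ₋₁ δ m and bound n Δ δ d₂ dₙ₋₁ m.
  bound : (n x y a b m : ℕ) → ℚ
  bound n x y a b m =
    let X = ℕ→ℚ x; Y = ℕ→ℚ y; A = ℕ→ℚ a; B = ℕ→ℚ b; s = ℕ→ℚ 2 * ℕ→ℚ m - X - Y in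
    X * X + Y * Y + divℕ (s * s) (n ℕ.∸ 2) + ½ * ((A - B) * (A - B))
      + divℕ (ℕ→ℚ (2 ℕ.* (n ℕ.∸ 2))) (n ℕ.∸ 4)
        * ((divℕ s (n ℕ.∸ 2) - ½ * (A + B)) * (divℕ s (n ℕ.∸ 2) - ½ * (A + B)))

  bound-decomposition : ∀ k x y a b m T Q E {M} →
    2 ℕ.* m ≡ x ℕ.+ y ℕ.+ (T ℕ.+ a ℕ.+ b) →
    M ≡ x ℕ.* x ℕ.+ y ℕ.* y ℕ.+ (Q ℕ.+ a ℕ.* a ℕ.+ b ℕ.* b) →
    suc k ℕ.* Q ≡ T ℕ.* T ℕ.+ E →
    ℕ→ℚ M ≡ bound (5 ℕ.+ k) x y a b m + divℕ (ℕ→ℚ E) (suc k)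
  bound-decomposition k x y a b m T Q E 2m≡ refl KQ≡T²+E =
    trans cast-M (bound-identity {K = ℕ→ℚ (suc k)} {u = + 1 / (3 ℕ.+ k)} {v = + 1 / suc k}
      u-inverse (1/suc*ℕ→ℚ≡1 k) (ℕ→ℚ x) (ℕ→ℚ y) (ℕ→ℚ a) (ℕ→ℚ b) (ℕ→ℚ T) (ℕ→ℚ Q) (ℕ→ℚ E)
      cast-2m cast-c cast-KQ)
    where
    u-inverse : (+ 1 / (3 ℕ.+ k)) * (ℕ→ℚ 2 + ℕ→ℚ (suc k)) ≡ 1ℚ
    u-inverse = trans (cong ((+ 1 / (3 ℕ.+ k)) *_) (sym (ℕ→ℚ-homo-+ 2 (suc k))))
                      (1/suc*ℕ→ℚ≡1 (2 ℕ.+ k))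
    homo-+ : ∀ m n {p q} → ℕ→ℚ m ≡ p → ℕ→ℚ n ≡ q → ℕ→ℚ (m ℕ.+ n) ≡ p + q
    homo-+ m n m≡p n≡q = trans (ℕ→ℚ-homo-+ m n) (cong₂ _+_ m≡p n≡q)
    square : ∀ n → ℕ→ℚ (n ℕ.* n) ≡ ℕ→ℚ n * ℕ→ℚ n
    square n = ℕ→ℚ-homo-* n n
    cast-M : ℕ→ℚ (x ℕ.* x ℕ.+ y ℕ.* y ℕ.+ (Q ℕ.+ a ℕ.* a ℕ.+ b ℕ.* b))
             ≡ ℕ→ℚ x * ℕ→ℚ x + ℕ→ℚ y * ℕ→ℚ y + (ℕ→ℚ Q + ℕ→ℚ a * ℕ→ℚ a + ℕ→ℚ b * ℕ→ℚ b)
    cast-M = homo-+ (x ℕ.* x ℕ.+ y ℕ.* y) (Q ℕ.+ a ℕ.* a ℕ.+ b ℕ.* b)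
      (homo-+ (x ℕ.* x) (y ℕ.* y) (square x) (square y))
      (homo-+ (Q ℕ.+ a ℕ.* a) (b ℕ.* b) (homo-+ Q (a ℕ.* a) refl (square a)) (square b))
    cast-2m : ℕ→ℚ 2 * ℕ→ℚ m ≡ ℕ→ℚ x + ℕ→ℚ y + (ℕ→ℚ T + ℕ→ℚ a + ℕ→ℚ b)
    cast-2m = trans (sym (ℕ→ℚ-homo-* 2 m)) (trans (cong ℕ→ℚ 2m≡)
      (homo-+ (x ℕ.+ y) (T ℕ.+ a ℕ.+ b)
        (ℕ→ℚ-homo-+ x y) (homo-+ (T ℕ.+ a) b (ℕ→ℚ-homo-+ T a) refl)))
    cast-c : ℕ→ℚ (2 ℕ.* (3 ℕ.+ k)) ≡ ℕ→ℚ 2 * (ℕ→ℚ 2 + ℕ→ℚ (suc k))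
    cast-c = trans (ℕ→ℚ-homo-* 2 (3 ℕ.+ k)) (cong (ℕ→ℚ 2 *_) (ℕ→ℚ-homo-+ 2 (suc k)))
    cast-KQ : ℕ→ℚ (suc k) * ℕ→ℚ Q ≡ ℕ→ℚ T * ℕ→ℚ T + ℕ→ℚ E
    cast-KQ = trans (sym (ℕ→ℚ-homo-* (suc k) Q))
      (trans (cong ℕ→ℚ KQ≡T²+E) (homo-+ (T ℕ.* T) E (square T) refl))

  ≤-+-divℕ : ∀ e k {p b} → p ≡ b + divℕ (ℕ→ℚ e) (suc k) → b ≤ℚ p
  ≤-+-divℕ e k {b = b} refl =
    subst (_≤ℚ b + e/K) (ℚ.+-identityʳ b) (ℚ.+-monoʳ-≤ b (ℚ.nonNegative⁻¹ e/K {{e/K-nonNeg}}))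
    where
    e/K : ℚ
    e/K = divℕ (ℕ→ℚ e) (suc k)
    e/K-nonNeg : NonNegative e/K
    e/K-nonNeg = ℚ.nonNeg*nonNeg⇒nonNeg
      (ℕ→ℚ e) {{ℚ.normalize-nonNeg e 1}} (+ 1 / suc k) {{ℚ.normalize-nonNeg 1 (suc k)}}

  divℕ≡0⇒≡0 : ∀ {e k} → divℕ (ℕ→ℚ e) (suc k) ≡ 0ℚ → e ≡ 0
  divℕ≡0⇒≡0 {e} {k} e/K≡0 = ℕ→ℚ-injective (begin
    ℕ→ℚ e                                    ≡⟨ ℚ.*-identityʳ (ℕ→ℚ e) ⟨
    ℕ→ℚ e * 1ℚ                               ≡⟨ cong (ℕ→ℚ e *_) (1/suc*ℕ→ℚ≡1 k) ⟨
    ℕ→ℚ e * ((+ 1 / suc k) * ℕ→ℚ (suc k))   ≡⟨ ℚ.*-assoc (ℕ→ℚ e) _ _ ⟨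
    divℕ (ℕ→ℚ e) (suc k) * ℕ→ℚ (suc k)      ≡⟨ cong (_* ℕ→ℚ (suc k)) e/K≡0 ⟩
    0ℚ * ℕ→ℚ (suc k)                         ≡⟨ ℚ.*-zeroˡ (ℕ→ℚ (suc k)) ⟩
    0ℚ                                       ∎)

  ≡-+-divℕ⇔≡0 : ∀ e k {p b} → p ≡ b + divℕ (ℕ→ℚ e) (suc k) → (p ≡ b) ⇔ (e ≡ 0)
  ≡-+-divℕ⇔≡0 e k {b = b} refl = mk⇔
    (λ eq → divℕ≡0⇒≡0 {e} {k} (identityʳ-unique b _ eq))
    (λ { refl → trans (cong (_+_ b) (ℚ.*-zeroˡ (+ 1 / suc k))) (ℚ.+-identityʳ b) })

open BoundIdentity using (bound-decomposition; ≤-+-divℕ; ≡-+-divℕ⇔≡0)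

open import Data.Nat using (_+_; _*_; ∣_-_∣; _<ᵇ_; _<?_)
open import Data.Nat.Properties
  using ( ≤-total; ≤-refl; ≤-trans; ≤-antisym; ≮⇒≥; <-asym; m≤m+n; m≤n+m; n≤1+n
        ; +-comm; *-comm; +-identityʳ; *-zeroʳ; m+n≡0⇒m≡0; m+n≡0⇒n≡0; m*n≡0⇒m≡0∨n≡0
        ; m≤n⇒∃[o]m+o≡n; ∣-∣-comm; ∣m-m+n∣≡n; ∣n-n∣≡0; ∣m-n∣≡0⇒m≡n
        ; <ᵇ-reflects-<; +-0-commutativeMonoid )
open import Data.Nat.Tactic.RingSolver using (solve-∀)
open import Data.Nat.ListAction using (sum)
open import Data.Nat.ListAction.Properties using (sum-++)
open import Data.List
  using (List; []; _∷_; _++_; _∷ʳ_; map; length; applyUpTo; tabulate; allFin)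
open import Data.List.Properties
  using (applyUpTo-∷ʳ; ++-assoc; map-++; map-∘; map-tabulate; tabulate-cong; length-applyUpTo)
open import Data.List.Relation.Unary.All as All using (All; []; _∷_)
open import Data.List.Relation.Unary.All.Properties using (applyUpTo⁺₁; applyUpTo⁻)
open import Data.Fin as Fin using (Fin; toℕ; fromℕ<)
open import Data.Fin.Properties using (toℕ<n; fromℕ<-toℕ; toℕ-injective)
open import Data.Bool using (true; false; if_then_else_)
open import Data.Sum using (inj₁; inj₂; reduce)
open import Algebra.Properties.CommutativeMonoid.Sum +-0-commutativeMonoid
  using (sum-syntax; ∑-comm; ∑-distrib-+; sum-cong-≗)
open import Function using (_∘_; id)
open import Function.Construct.Composition using (_⇔-∘_)
open import Function.Construct.Symmetry using (⇔-sym)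
open import Relation.Nullary using (yes; no; contradiction)
open import Relation.Nullary.Reflects using (ofʸ; ofⁿ)
open ≡-Reasoning

sq : ℕ → ℕ
sq x = x * x

sqDist : ℕ → ℕ → ℕ
sqDist x y = sq ∣ x - y ∣

pairwiseSqDist : List ℕ → ℕ
pairwiseSqDist []       = 0
pairwiseSqDist (x ∷ xs) = sum (map (sqDist x) xs) + pairwiseSqDist xs

sqDist-self : ∀ x → sqDist x x ≡ 0
sqDist-self x = cong sq (∣n-n∣≡0 x)

sqDist≡0⇒≡ : ∀ {x y} → sqDist x y ≡ 0 → y ≡ x
sqDist≡0⇒≡ {x} {y} eq = sym (∣m-n∣≡0⇒m≡n (reduce (m*n≡0⇒m≡0∨n≡0 ∣ x - y ∣ eq)))

sqDist-expand-≤ : ∀ {x y} → x ≤ y → sqDist x y + 2 * (x * y) ≡ sq x + sq y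
sqDist-expand-≤ {x} x≤y with c , refl ← m≤n⇒∃[o]m+o≡n x≤y = begin
  sqDist x (x + c) + 2 * (x * (x + c))  ≡⟨ cong (λ e → sq e + 2 * (x * (x + c))) (∣m-m+n∣≡n x c) ⟩
  sq c + 2 * (x * (x + c))              ≡⟨ expand x c ⟩
  sq x + sq (x + c)                     ∎
  where
  expand : ∀ x c → c * c + 2 * (x * (x + c)) ≡ x * x + (x + c) * (x + c)
  expand = solve-∀

sqDist-expand : ∀ x y → sqDist x y + 2 * (x * y) ≡ sq x + sq y
sqDist-expand x y with ≤-total x y
... | inj₁ x≤y = sqDist-expand-≤ x≤y
... | inj₂ y≤x = begin
  sqDist x y + 2 * (x * y)  ≡⟨ cong₂ (λ e p → sq e + 2 * p) (∣-∣-comm x y) (*-comm x y) ⟩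
  sqDist y x + 2 * (y * x)  ≡⟨ sqDist-expand-≤ y≤x ⟩
  sq y + sq x               ≡⟨ +-comm (sq y) (sq x) ⟩
  sq x + sq y               ∎

sum-sqDist-expand : ∀ x ys →
  sum (map (sqDist x) ys) + 2 * (x * sum ys) ≡ sum (map sq ys) + length ys * sq x
sum-sqDist-expand x []       = cong (2 *_) (*-zeroʳ x)
sum-sqDist-expand x (y ∷ ys) = begin
  sqDist x y + D + 2 * (x * (y + S))
    ≡⟨ regroup (sqDist x y) D x y S ⟩
  sqDist x y + 2 * (x * y) + (D + 2 * (x * S))
    ≡⟨ cong₂ _+_ (sqDist-expand x y) (sum-sqDist-expand x ys) ⟩
  sq x + sq y + (Q + length ys * sq x)
    ≡⟨ collect (sq x) (sq y) Q (length ys) ⟩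
  sq y + Q + suc (length ys) * sq x
    ∎
  where
  D S Q : ℕ
  D = sum (map (sqDist x) ys)
  S = sum ys
  Q = sum (map sq ys)
  regroup : ∀ d D x y S → d + D + 2 * (x * (y + S)) ≡ d + 2 * (x * y) + (D + 2 * (x * S))
  regroup = solve-∀
  collect : ∀ xx yy Q L → xx + yy + (Q + L * xx) ≡ yy + Q + suc L * xx
  collect = solve-∀

lagrange-identity : ∀ xs → length xs * sum (map sq xs) ≡ sq (sum xs) + pairwiseSqDist xs
lagrange-identity []       = refl
lagrange-identity (x ∷ xs) = begin
  suc L * (sq x + Q)
    ≡⟨ expand (sq x) Q L ⟩
  sq x + (Q + L * sq x) + L * Q
    ≡⟨ cong₂ (λ e f → sq x + e + f) (sym (sum-sqDist-expand x xs)) (lagrange-identity xs) ⟩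
  sq x + (D + 2 * (x * S)) + (sq S + P)
    ≡⟨ collect x S D P ⟩
  sq (x + S) + (D + P)
    ∎
  where
  L Q S D P : ℕ
  L = length xs
  Q = sum (map sq xs)
  S = sum xs
  D = sum (map (sqDist x) xs)
  P = pairwiseSqDist xs
  expand : ∀ xx Q L → suc L * (xx + Q) ≡ xx + (Q + L * xx) + L * Q
  expand = solve-∀
  collect : ∀ x S D P → x * x + (D + 2 * (x * S)) + (S * S + P) ≡ (x + S) * (x + S) + (D + P)
  collect = solve-∀

sum-map≡0⇒All : ∀ {A : Set} (f : A → ℕ) xs → sum (map f xs) ≡ 0 → All (λ x → f x ≡ 0) xs
sum-map≡0⇒All f []       _  = []
sum-map≡0⇒All f (x ∷ xs) eq = m+n≡0⇒m≡0 (f x) eq ∷ sum-map≡0⇒All f xs (m+n≡0⇒n≡0 (f x) eq)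

All⇒sum-map≡0 : ∀ {A : Set} {f : A → ℕ} {xs} → All (λ x → f x ≡ 0) xs → sum (map f xs) ≡ 0
All⇒sum-map≡0 []             = refl
All⇒sum-map≡0 (fx≡0 ∷ fxs≡0) = cong₂ _+_ fx≡0 (All⇒sum-map≡0 fxs≡0)

All≡⇒pairwiseSqDist≡0 : ∀ {x xs} → All (_≡ x) xs → pairwiseSqDist xs ≡ 0
All≡⇒pairwiseSqDist≡0     []          = refl
All≡⇒pairwiseSqDist≡0 {x} (refl ∷ eqs) =
  cong₂ _+_ (All⇒sum-map≡0 (All.map (λ { refl → sqDist-self x }) eqs)) (All≡⇒pairwiseSqDist≡0 eqs)

pairwiseSqDist≡0⇔All≡ : ∀ x xs → pairwiseSqDist (x ∷ xs) ≡ 0 ⇔ All (_≡ x) xs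
pairwiseSqDist≡0⇔All≡ x xs = mk⇔
  (λ eq → All.map sqDist≡0⇒≡ (sum-map≡0⇒All (sqDist x) xs (m+n≡0⇒m≡0 _ eq)))
  (λ eqs → All≡⇒pairwiseSqDist≡0 (refl ∷ eqs))

applyUpTo-∷ʳ² : ∀ {A : Set} (f : ℕ → A) n →
                applyUpTo f (2 + n) ≡ applyUpTo f n ++ f n ∷ f (suc n) ∷ []
applyUpTo-∷ʳ² f n = begin
  applyUpTo f (2 + n)                    ≡⟨ applyUpTo-∷ʳ f (suc n) ⟨
  applyUpTo f (suc n) ∷ʳ f (suc n)       ≡⟨ cong (_∷ʳ f (suc n)) (applyUpTo-∷ʳ f n) ⟨
  applyUpTo f n ∷ʳ f n ∷ʳ f (suc n)      ≡⟨ ++-assoc (applyUpTo f n) (f n ∷ []) (f (suc n) ∷ []) ⟩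
  applyUpTo f n ++ f n ∷ f (suc n) ∷ []  ∎

tabulate∘toℕ≡applyUpTo : ∀ {A : Set} n (f : ℕ → A) → tabulate {n = n} (f ∘ toℕ) ≡ applyUpTo f n
tabulate∘toℕ≡applyUpTo zero    f = refl
tabulate∘toℕ≡applyUpTo (suc n) f = cong (f 0 ∷_) (tabulate∘toℕ≡applyUpTo n (f ∘ suc))

sum-tabulate : ∀ {n} (f : Fin n → ℕ) → sum (tabulate f) ≡ ∑[ i < n ] f i
sum-tabulate {zero}  f = refl
sum-tabulate {suc n} f = cong (f Fin.zero +_) (sum-tabulate (f ∘ Fin.suc))

sum-allFin : ∀ {n} (f : Fin n → ℕ) → sum (map f (allFin n)) ≡ ∑[ i < n ] f i
sum-allFin f = trans (cong sum (map-tabulate id f)) (sum-tabulate f)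

sum-∷∷++∷∷ : ∀ x y ms a b → sum (x ∷ y ∷ ms ++ a ∷ b ∷ []) ≡ x + y + (sum ms + a + b)
sum-∷∷++∷∷ x y ms a b = begin
  x + (y + sum (ms ++ a ∷ b ∷ []))    ≡⟨ cong (λ t → x + (y + t)) (sum-++ ms (a ∷ b ∷ [])) ⟩
  x + (y + (sum ms + (a + (b + 0))))  ≡⟨ regroup x y (sum ms) a b ⟩
  x + y + (sum ms + a + b)            ∎
  where
  regroup : ∀ x y s a b → x + (y + (s + (a + (b + 0)))) ≡ x + y + (s + a + b)
  regroup = solve-∀

d-suc : ∀ {n} (G : SimpleGraph n) {j} (j<n : j < n) → d G (suc j) ≡ deg G (fromℕ< j<n)
d-suc {suc n} G {j} j<n with j <? suc n
... | yes _   = refl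
... | no j≮n = contradiction j<n j≮n

module _ {n} (G : SimpleGraph n) where

  d-suc-toℕ : ∀ i → d G (suc (toℕ i)) ≡ deg G i
  d-suc-toℕ i = trans (d-suc G (toℕ<n i)) (cong (deg G) (fromℕ<-toℕ i (toℕ<n i)))

  degrees≡applyUpTo : map (deg G) (allFin n) ≡ applyUpTo (d G ∘ suc) n
  degrees≡applyUpTo = begin
    map (deg G) (allFin n)          ≡⟨ map-tabulate id (deg G) ⟩
    tabulate (deg G)                ≡⟨ tabulate-cong (λ i → sym (d-suc-toℕ i)) ⟩
    tabulate (d G ∘ suc ∘ toℕ {n})  ≡⟨ tabulate∘toℕ≡applyUpTo n (d G ∘ suc) ⟩
    applyUpTo (d G ∘ suc) n         ∎

  adjℕ upperAdjℕ : Fin n → Fin n → ℕ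
  adjℕ i j = if adj G i j then 1 else 0
  upperAdjℕ i j = if toℕ i <ᵇ toℕ j then adjℕ i j else 0

  adjℕ-split : ∀ i j → adjℕ i j ≡ upperAdjℕ i j + upperAdjℕ j i
  adjℕ-split i j
    with toℕ i <ᵇ toℕ j | <ᵇ-reflects-< (toℕ i) (toℕ j)
       | toℕ j <ᵇ toℕ i | <ᵇ-reflects-< (toℕ j) (toℕ i)
  ... | true  | ofʸ i<j | true  | ofʸ j<i = contradiction j<i (<-asym i<j)
  ... | true  | _       | false | _       = sym (+-identityʳ (adjℕ i j))
  ... | false | _       | true  | _       = cong (λ b → if b then 1 else 0) (SimpleGraph.sym G i j)
  ... | false | ofⁿ i≮j | false | ofⁿ j≮i
    with refl ← toℕ-injective {i = i} {j} (≤-antisym (≮⇒≥ j≮i) (≮⇒≥ i≮j))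
    = cong (λ b → if b then 1 else 0) (irrefl G i)

  handshake : sum (map (deg G) (allFin n)) ≡ 2 * edges G
  handshake = begin
    sum (map (deg G) (allFin n))
      ≡⟨ sum-allFin (deg G) ⟩
    ∑[ i < n ] deg G i
      ≡⟨ sum-cong-≗ (λ i → trans (sum-allFin (adjℕ i)) (sum-cong-≗ (adjℕ-split i))) ⟩
    ∑[ i < n ] ∑[ j < n ] (upperAdjℕ i j + upperAdjℕ j i)
      ≡⟨ sum-cong-≗ (λ i → ∑-distrib-+ (upperAdjℕ i) (λ j → upperAdjℕ j i)) ⟩
    ∑[ i < n ] (∑[ j < n ] upperAdjℕ i j + ∑[ j < n ] upperAdjℕ j i)
      ≡⟨ ∑-distrib-+ (λ i → ∑[ j < n ] upperAdjℕ i j) (λ i → ∑[ j < n ] upperAdjℕ j i) ⟩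
    m + ∑[ i < n ] ∑[ j < n ] upperAdjℕ j i
      ≡⟨ cong (m +_) (∑-comm (λ i j → upperAdjℕ j i)) ⟩
    m + m
      ≡⟨ cong (m +_) (+-identityʳ m) ⟨
    2 * m
      ≡⟨ cong (2 *_) edges≡m ⟨
    2 * edges G
      ∎
    where
    m : ℕ
    m = ∑[ i < n ] ∑[ j < n ] upperAdjℕ i j
    edges≡m : edges G ≡ m
    edges≡m = trans (sum-allFin (λ i → sum (map (upperAdjℕ i) (allFin n))))
                    (sum-cong-≗ (λ i → sum-allFin (upperAdjℕ i)))

  Γ-mono : ∀ {i i′ j′ j} → i ≤ i′ → i′ ≤ j′ → j′ ≤ j → Γ i j G → Γ i′ j′ G
  Γ-mono i≤i′ i′≤j′ j′≤j γ l i′≤l l≤j′ =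
    trans (γ l (≤-trans i≤i′ i′≤l) (≤-trans l≤j′ j′≤j)) (sym (γ _ i≤i′ (≤-trans i′≤j′ j′≤j)))

  regular⇒Γ₁ₙ : regular G → Γ 1 n G
  regular⇒Γ₁ₙ reg (suc l) _ l<n =
    trans (d-suc G l<n) (trans (reg _ _) (sym (d-suc G (≤-trans (s≤s z≤n) l<n))))

module _ {k} (G : SimpleGraph (5 + k)) where

  Δ d₂ dₙ₋₁ δ : ℕ
  Δ    = d G 1
  d₂   = d G 2
  dₙ₋₁ = d G (4 + k)
  δ    = d G (5 + k)

  middleDegrees : List ℕ
  middleDegrees = applyUpTo (λ i → d G (3 + i)) (suc k)

  degrees-split : map (deg G) (allFin (5 + k))
                ≡ Δ ∷ d₂ ∷ middleDegrees ++ dₙ₋₁ ∷ δ ∷ []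
  degrees-split = trans (degrees≡applyUpTo G)
    (cong (λ ds → Δ ∷ d₂ ∷ ds) (applyUpTo-∷ʳ² (λ i → d G (3 + i)) (suc k)))

  handshake-split : 2 * edges G ≡ Δ + d₂ + (sum middleDegrees + dₙ₋₁ + δ)
  handshake-split = begin
    2 * edges G                                    ≡⟨ handshake G ⟨
    sum (map (deg G) (allFin (5 + k)))             ≡⟨ cong sum degrees-split ⟩
    sum (Δ ∷ d₂ ∷ middleDegrees ++ dₙ₋₁ ∷ δ ∷ [])  ≡⟨ sum-∷∷++∷∷ Δ d₂ middleDegrees dₙ₋₁ δ ⟩
    Δ + d₂ + (sum middleDegrees + dₙ₋₁ + δ)        ∎

  M1-split : M1 G ≡ sq Δ + sq d₂ + (sum (map sq middleDegrees) + sq dₙ₋₁ + sq δ)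
  M1-split = begin
    M1 G
      ≡⟨ cong sum (map-∘ {g = sq} {f = deg G} (allFin (5 + k))) ⟩
    sum (map sq (map (deg G) (allFin (5 + k))))
      ≡⟨ cong (sum ∘ map sq) degrees-split ⟩
    sum (sq Δ ∷ sq d₂ ∷ map sq (middleDegrees ++ dₙ₋₁ ∷ δ ∷ []))
      ≡⟨ cong (λ ds → sum (sq Δ ∷ sq d₂ ∷ ds)) (map-++ sq middleDegrees (dₙ₋₁ ∷ δ ∷ [])) ⟩
    sum (sq Δ ∷ sq d₂ ∷ map sq middleDegrees ++ sq dₙ₋₁ ∷ sq δ ∷ [])
      ≡⟨ sum-∷∷++∷∷ (sq Δ) (sq d₂) (map sq middleDegrees) (sq dₙ₋₁) (sq δ) ⟩
    sq Δ + sq d₂ + (sum (map sq middleDegrees) + sq dₙ₋₁ + sq δ)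
      ∎

  lagrange-middle : suc k * sum (map sq middleDegrees)
                  ≡ sq (sum middleDegrees) + pairwiseSqDist middleDegrees
  lagrange-middle =
    trans (cong (_* sum (map sq middleDegrees))
                (sym (length-applyUpTo (λ i → d G (3 + i)) (suc k))))
          (lagrange-identity middleDegrees)

  M1≡bound1+excess : ℕ→ℚ (M1 G) ≡ bound1 G +ℚ divℕ (ℕ→ℚ (pairwiseSqDist middleDegrees)) (suc k)
  M1≡bound1+excess = bound-decomposition k Δ d₂ dₙ₋₁ δ (edges G)
    (sum middleDegrees) (sum (map sq middleDegrees)) (pairwiseSqDist middleDegrees)
    handshake-split M1-split lagrange-middle

  M1≡bound2+excess : ℕ→ℚ (M1 G) ≡ bound2 G +ℚ divℕ (ℕ→ℚ (pairwiseSqDist middleDegrees)) (suc k)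
  M1≡bound2+excess = bound-decomposition k Δ δ d₂ dₙ₋₁ (edges G)
    (sum middleDegrees) (sum (map sq middleDegrees)) (pairwiseSqDist middleDegrees)
    (trans handshake-split (swap Δ d₂ (sum middleDegrees) dₙ₋₁ δ))
    (trans M1-split (swap (sq Δ) (sq d₂) (sum (map sq middleDegrees)) (sq dₙ₋₁) (sq δ)))
    lagrange-middle
    where
    swap : ∀ x y z a b → x + y + (z + a + b) ≡ x + b + (z + y + a)
    swap = solve-∀

  All≡d₃⇔Γ : All (_≡ d G 3) (applyUpTo (λ i → d G (4 + i)) k) ⇔ Γ 3 (3 + k) G
  All≡d₃⇔Γ = mk⇔ to from
    where
    to : All (_≡ d G 3) (applyUpTo (λ i → d G (4 + i)) k) → Γ 3 (3 + k) G
    to _ 1 (s≤s ()) _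
    to _ 2 (s≤s (s≤s ())) _
    to _ 3 _ _ = refl
    to all (suc (suc (suc (suc i)))) _ (s≤s (s≤s (s≤s i<k))) =
      applyUpTo⁻ (λ i → d G (4 + i)) k all i<k
    from : Γ 3 (3 + k) G → All (_≡ d G 3) (applyUpTo (λ i → d G (4 + i)) k)
    from γ = applyUpTo⁺₁ (λ i → d G (4 + i)) k
      (λ i<k → γ _ (s≤s (s≤s (s≤s z≤n))) (s≤s (s≤s (s≤s i<k))))

  -- middleDegrees unfolds to d G 3 ∷ applyUpTo (λ i → d G (4 + i)) k.
  pairwiseSqDist≡0⇔Γ : pairwiseSqDist middleDegrees ≡ 0 ⇔ Γ 3 (3 + k) G
  pairwiseSqDist≡0⇔Γ =
    All≡d₃⇔Γ ⇔-∘ pairwiseSqDist≡0⇔All≡ (d G 3) (applyUpTo (λ i → d G (4 + i)) k)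

  EqualityCase⇔Γ : EqualityCase G ⇔ Γ 3 (3 + k) G
  EqualityCase⇔Γ = mk⇔ to (inj₂ ∘ inj₁)
    where
    widen : ∀ {i j} → i ≤ 3 → 3 + k ≤ j → Γ i j G → Γ 3 (3 + k) G
    widen i≤3 3+k≤j = Γ-mono G i≤3 (m≤m+n 3 k) 3+k≤j
    1≤3 : 1 ≤ 3
    1≤3 = s≤s z≤n
    2≤3 : 2 ≤ 3
    2≤3 = s≤s (s≤s z≤n)
    to : EqualityCase G → Γ 3 (3 + k) G
    to (inj₁ reg) = widen 1≤3 (m≤n+m _ 2) (regular⇒Γ₁ₙ G reg)
    to (inj₂ (inj₁ γ)) = γ
    to (inj₂ (inj₂ (inj₁ γ))) = widen 2≤3 ≤-refl γ
    to (inj₂ (inj₂ (inj₂ (inj₁ γ)))) = widen ≤-refl (n≤1+n _) γ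
    to (inj₂ (inj₂ (inj₂ (inj₂ (inj₁ γ))))) = widen 2≤3 (n≤1+n _) γ
    to (inj₂ (inj₂ (inj₂ (inj₂ (inj₂ (inj₁ γ)))))) = widen ≤-refl (m≤n+m _ 2) γ
    to (inj₂ (inj₂ (inj₂ (inj₂ (inj₂ (inj₂ (inj₁ γ))))))) = widen 2≤3 (m≤n+m _ 2) γ
    to (inj₂ (inj₂ (inj₂ (inj₂ (inj₂ (inj₂ (inj₂ (inj₁ γ)))))))) = widen 1≤3 ≤-refl γ
    to (inj₂ (inj₂ (inj₂ (inj₂ (inj₂ (inj₂ (inj₂ (inj₂ γ)))))))) = widen 1≤3 (n≤1+n _) γ

corollary7 : (n : ℕ) (G : SimpleGraph n) → 5 ≤ n → DegreeOrdered G → 0 < d G n →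
    (bound1 G ≤ℚ ℕ→ℚ (M1 G)) × (bound2 G ≤ℚ ℕ→ℚ (M1 G))
    × ((ℕ→ℚ (M1 G) ≡ bound1 G) ⇔ EqualityCase G)
    × ((ℕ→ℚ (M1 G) ≡ bound2 G) ⇔ EqualityCase G)
corollary7 _ G (s≤s (s≤s (s≤s (s≤s (s≤s {n = k} _))))) _ _ =
    ≤-+-divℕ E k (M1≡bound1+excess G) , ≤-+-divℕ E k (M1≡bound2+excess G)
  , equality (M1≡bound1+excess G) , equality (M1≡bound2+excess G)
  where
  E : ℕ
  E = pairwiseSqDist (middleDegrees G)
  equality : ∀ {b} → ℕ→ℚ (M1 G) ≡ b +ℚ divℕ (ℕ→ℚ E) (suc k) →
             (ℕ→ℚ (M1 G) ≡ b) ⇔ EqualityCase G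
  equality excess =
    ⇔-sym (EqualityCase⇔Γ G) ⇔-∘ (pairwiseSqDist≡0⇔Γ G ⇔-∘ ≡-+-divℕ⇔≡0 E k excess)
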